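{- The map $\Upsilon:\mathcal{C}_e\to H\rtimes C$, $(\alpha_0,\alpha_1,\dots,\alpha_k)\mapsto(\alpha_0)\otimes(0,\alpha_1,\dots,\alpha_k)$, is an isomorphism of Hopf algebras.
   Context: $\mathbb{K}$ is a field of characteristic $0$. $\mathcal{C}_e$ (extended compositions) has basis $(\alpha_0,\alpha_1,\dots,\alpha_p)$ with $p\ge0$, $\alpha_0\in\mathbb{N}$, $\alpha_i\in\mathbb{N}^*$ ($i\ge1$); product $(\alpha_0,\dots,\alpha_s)\ast(\beta_0,\dots,\beta_k)=(\alpha_0+\beta_0,\alpha_1,\dots,\alpha_s,\beta_1,\dots,\beta_k)$ (unit $(0)$); coproduct $\Delta((\alpha_0,\dots,\alpha_p))=\sum_{a=0}^{\alpha_0}\sum_{n=0}^{p}\sum_{1\le i_1<\dots<i_n\le p}\sum_{1\le k_{i_j}\le\alpha_{i_j}}\binom{\alpha_0}{a}\prod_{j=1}^n\binom{\alpha_{i_j}}{k_{i_j}}\,(a,k_{i_1},\dots,k_{i_n})\otimes\big(\alpha_0-a+\sum_{j=1}^n(\alpha_{i_j}-k_{i_j}),\alpha_{u_1},\dots,\alpha_{u_{p-n}}\big)$, where $\{u_1<\dots<u_{p-n}\}=\{1,\dots,p\}\setminus\{i_1,\dots,i_n\}$. (This is the quotient of the packed words Hopf algebra by the identification of a word with all its letter permutations.) $H=\mathbb{K}[(1)]$ is the polynomial Hopf algebra with $(1)$ primitive and $(m):=(1)^m$. $C=T\langle(0,n),n\ge1\rangle$ is the tensor algebra with basis $(0,n_1,\dots,n_q)=(0,n_1)\cdots(0,n_q)$,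 concatenation product, and each $(0,n)$ primitive. $\rho:C\to C\otimes H$ is the algebra morphism with $\rho((0,n))=\sum_{k=1}^{n-1}\binom{n}{k}(0,k)\otimes(n-k)+(0,n)\otimes1_H$; writing $\rho(c)=\sum c_{(1)}\otimes c_{(2)}$ and $\Delta_C(c)=\sum c'\otimes c''$, $\Delta_H(h)=\sum h_1\otimes h_2$, the semi-direct coproduct Hopf algebra $H\rtimes C$ is $H\otimes C$ with product $(h\otimes c)(h'\otimes c')=hh'\otimes cc'$, unit $1_H\otimes1_C$, counit $\varepsilon_H\otimes\varepsilon_C$ and coproduct $\overline{\Delta}(h\otimes c)=\sum(h_1\otimes c'_{(1)})\otimes(h_2c'_{(2)}\otimes c'')$ (Molnar). -}

module Defs where

open import Level using (Level; _⊔_) renaming (suc to lsuc)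
open import Algebra.Bundles using (CommutativeRing)
open import Data.Nat using (ℕ; zero; suc; _+_; _∸_)
open import Data.Nat.Combinatorics using (_C_)
open import Data.Nat.Properties using () renaming (_≟_ to _≟ℕ_)
open import Data.List using (List; []; _∷_; _++_; map; concatMap; foldr; upTo)
import Data.List.Properties as LP
open import Data.Product using (_×_; _,_; Σ; ∃)
import Data.Product.Properties as PP
open import Data.Bool using (if_then_else_)
open import Relation.Nullary using (¬_; does; yes; no)
open import Relation.Binary.Definitions using (DecidableEquality)
open import Relation.Binary.PropositionalEquality using (_≡_; refl; cong)

-- Positive naturals ℕ* : (1+ n) stands for n + 1.

data ℕ* : Set where
  1+ : ℕ → ℕ*

val : ℕ* → ℕ
val (1+ n) = suc n

_≟*_ : DecidableEquality ℕ*
1+ m ≟* 1+ n with m ≟ℕ n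
... | yes refl = yes refl
... | no m≢n = no λ { refl → m≢n refl }

-- Bases.
-- Extended composition (α₀, α₁, …, α_p) is the pair (α₀ , [α₁,…,α_p]).
ExtComp : Set
ExtComp = ℕ × List ℕ*

-- Basis of H = K[(1)] : m ↦ (m) = (1)^m.
HBasis : Set
HBasis = ℕ

-- Basis of C = T⟨(0,n)⟩ : words (0,n₁,…,n_q) = (0,n₁)⋯(0,n_q) ↦ [n₁,…,n_q].
CBasis : Set
CBasis = List ℕ*

HCBasis : Set
HCBasis = HBasis × CBasis

_≟L_ : DecidableEquality (List ℕ*)
_≟L_ = LP.≡-dec _≟*_

_≟E_ : DecidableEquality ExtComp
_≟E_ = PP.≡-dec _≟ℕ_ _≟L_

_≟E2_ : DecidableEquality (ExtComp × ExtComp)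
_≟E2_ = PP.≡-dec _≟E_ _≟E_

_≟HC2_ : DecidableEquality (HCBasis × HCBasis)
_≟HC2_ = PP.≡-dec _≟E_ _≟E_

module _ {c ℓ : Level} (R : CommutativeRing c ℓ) where
  open CommutativeRing R renaming (_+_ to _+ᴷ_; _*_ to _*ᴷ_)
  fromℕ : ℕ → Carrier
  fromℕ zero = 0#
  fromℕ (suc n) = 1# +ᴷ fromℕ n

record CharZeroField (c ℓ : Level) : Set (lsuc (c ⊔ ℓ)) where
  field
    commRing : CommutativeRing c ℓ
  open CommutativeRing commRing renaming (_+_ to _+ᴷ_; _*_ to _*ᴷ_)
  field
    0≉1      : ¬ (0# ≈ 1#)
    inverse  : ∀ x → ¬ (x ≈ 0#) → Σ Carrier (λ y → x *ᴷ y ≈ 1#)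
    charZero : ∀ n → ¬ (fromℕ commRing (suc n) ≈ 0#)

-- Free K-modules on a basis B: formal finite linear combinations,
-- compared by their coefficient on each basis element.

module Over {c ℓ : Level} (F : CharZeroField c ℓ) where
  open CharZeroField F
  open CommutativeRing commRing renaming (_+_ to _+ᴷ_; _*_ to _*ᴷ_)

  K : Set c
  K = Carrier

  Lin : Set → Set c
  Lin B = List (K × B)

  ⟦_⟧ : ℕ → K
  ⟦ n ⟧ = fromℕ commRing n

  ret : {B : Set} → B → Lin B
  ret b = (1# , b) ∷ []

  scale : {B : Set} → K → Lin B → Lin B
  scale k = map (λ { (d , b) → (k *ᴷ d , b) })

  ext : {A B : Set} → (A → Lin B) → Lin A → Lin B
  ext f = concatMap (λ { (k , a) → scale k (f a) })

  bilin : {A B D : Set} → (A → B → Lin D) → Lin A → Lin B → Lin D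
  bilin f x y = ext (λ a → ext (f a) y) x

  _⊗ₘ_ : {A B A' B' : Set} → (A → Lin A') → (B → Lin B') → Lin (A × B) → Lin (A' × B')
  (f ⊗ₘ g) = ext (λ { (a , b) → bilin (λ a' b' → ret (a' , b')) (f a) (g b) })

  coeff : {B : Set} → DecidableEquality B → Lin B → B → K
  coeff _≟_ xs b = foldr (λ { (k , a) acc → if does (a ≟ b) then k +ᴷ acc else acc }) 0# xs

  Eq : {B : Set} → DecidableEquality B → Lin B → Lin B → Set ℓ
  Eq dec x y = ∀ b → coeff dec x b ≈ coeff dec y b

  mulCeB : ExtComp → ExtComp → Lin ExtComp
  mulCeB (a₀ , as) (b₀ , bs) = ret (a₀ + b₀ , as ++ bs)

  mulCe : Lin ExtComp → Lin ExtComp → Lin ExtComp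
  mulCe = bilin mulCeB

  unitCe : Lin ExtComp
  unitCe = ret (0 , [])

  -- Sum over the choices of 1 ≤ i₁ < … < i_n ≤ p (n ≥ 0) and
  -- 1 ≤ k_{i_j} ≤ α_{i_j}, with coefficient ∏ binom(α_{i_j}, k_{i_j}).
  -- Output: ([k_{i₁},…,k_{i_n}] , Σ_j (α_{i_j} - k_{i_j}) , [α_{u₁},…,α_{u_{p-n}}]).
  selections : List ℕ* → Lin (List ℕ* × ℕ × List ℕ*)
  selections [] = ret ([] , 0 , [])
  selections (α ∷ αs) =
    map (λ { (k , (ks , e , us)) → (k , (ks , e , α ∷ us)) }) (selections αs)
    ++ chosen α
    where
      chosen : ℕ* → Lin (List ℕ* × ℕ × List ℕ*)
      chosen (1+ m) =   -- α = m + 1, k = j + 1 with 0 ≤ j ≤ m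
        concatMap
          (λ j → map (λ { (k , (ks , e , us)) →
                          (⟦ suc m C suc j ⟧ *ᴷ k , (1+ j ∷ ks , (m ∸ j) + e , us)) })
                     (selections αs))
          (upTo (suc m))

  ΔCeB : ExtComp → Lin (ExtComp × ExtComp)
  ΔCeB (α₀ , αs) =
    concatMap
      (λ a → map (λ { (k , (ks , e , us)) →
                      (⟦ α₀ C a ⟧ *ᴷ k , ((a , ks) , ((α₀ ∸ a) + e , us))) })
                 (selections αs))
      (upTo (suc α₀))

  ΔCe : Lin ExtComp → Lin (ExtComp × ExtComp)
  ΔCe = ext ΔCeB

  εCeB : ExtComp → K
  εCeB (zero , []) = 1#
  εCeB (zero , _ ∷ _) = 0#
  εCeB (suc _ , _) = 0#

  εL : {B : Set} → (B → K) → Lin B → K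
  εL f = foldr (λ { (k , b) acc → k *ᴷ f b +ᴷ acc }) 0#

  εCe : Lin ExtComp → K
  εCe = εL εCeB

  mulHB : HBasis → HBasis → Lin HBasis
  mulHB m n = ret (m + n)

  mulHHB : HBasis × HBasis → HBasis × HBasis → Lin (HBasis × HBasis)
  mulHHB (a , b) (a' , b') = ret (a + a' , b + b')

  -- Δ_H is the algebra morphism with Δ_H((1)) = (1) ⊗ 1 + 1 ⊗ (1)
  ΔHB : HBasis → Lin (HBasis × HBasis)
  ΔHB zero = ret (0 , 0)
  ΔHB (suc m) = bilin mulHHB (ret (1 , 0) ++ ret (0 , 1)) (ΔHB m)

  εHB : HBasis → K
  εHB zero = 1#
  εHB (suc _) = 0#

  mulCCB : CBasis × CBasis → CBasis × CBasis → Lin (CBasis × CBasis)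
  mulCCB (u , v) (u' , v') = ret (u ++ u' , v ++ v')

  -- Δ_C is the algebra morphism with Δ_C((0,n)) = (0,n) ⊗ 1 + 1 ⊗ (0,n)
  ΔCB : CBasis → Lin (CBasis × CBasis)
  ΔCB [] = ret ([] , [])
  ΔCB (n ∷ w) = bilin mulCCB (ret (n ∷ [] , []) ++ ret ([] , n ∷ [])) (ΔCB w)

  εCB : CBasis → K
  εCB [] = 1#
  εCB (_ ∷ _) = 0#

  mulCHB : CBasis × HBasis → CBasis × HBasis → Lin (CBasis × HBasis)
  mulCHB (u , h) (u' , h') = ret (u ++ u' , h + h')

  -- ρ((0,n)) = Σ_{k=1}^{n-1} binom(n,k) (0,k) ⊗ (n-k) + (0,n) ⊗ 1_H
  -- with n = m + 1 and k = j + 1, 0 ≤ j ≤ m - 1.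
  ρletter : ℕ* → Lin (CBasis × HBasis)
  ρletter (1+ m) =
    map (λ j → (⟦ suc m C suc j ⟧ , (1+ j ∷ [] , m ∸ j))) (upTo m)
    ++ ret (1+ m ∷ [] , 0)

  ρB : CBasis → Lin (CBasis × HBasis)
  ρB [] = ret ([] , 0)
  ρB (n ∷ w) = bilin mulCHB (ρletter n) (ρB w)

  mulHCB : HCBasis → HCBasis → Lin HCBasis
  mulHCB (h , c) (h' , c') = ret (h + h' , c ++ c')

  mulHC : Lin HCBasis → Lin HCBasis → Lin HCBasis
  mulHC = bilin mulHCB

  unitHC : Lin HCBasis
  unitHC = ret (0 , [])

  -- Δ̄(h ⊗ c) = Σ (h₁ ⊗ c'₍₁₎) ⊗ (h₂ c'₍₂₎ ⊗ c'')
  ΔHCB : HCBasis → Lin (HCBasis × HCBasis)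
  ΔHCB (h , c) =
    ext (λ { (c' , c'') →
      ext (λ { (c'₁ , c'₂) →
        ext (λ { (h₁ , h₂) →
          ext (λ z → ret ((h₁ , c'₁) , (z , c''))) (mulHB h₂ c'₂) })
          (ΔHB h) })
        (ρB c') })
      (ΔCB c)

  ΔHC : Lin HCBasis → Lin (HCBasis × HCBasis)
  ΔHC = ext ΔHCB

  εHCB : HCBasis → K
  εHCB (h , c) = εHB h *ᴷ εCB c

  εHC : Lin HCBasis → K
  εHC = εL εHCB

  ΥB : ExtComp → Lin HCBasis
  ΥB (α₀ , αs) = ret (α₀ , αs)

  Υ : Lin ExtComp → Lin HCBasis
  Υ = ext ΥB

  _≋Ce_ : Lin ExtComp → Lin ExtComp → Set ℓ
  _≋Ce_ = Eq _≟E_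

  _≋HC_ : Lin HCBasis → Lin HCBasis → Set ℓ
  _≋HC_ = Eq _≟E_

  _≋HC²_ : Lin (HCBasis × HCBasis) → Lin (HCBasis × HCBasis) → Set ℓ
  _≋HC²_ = Eq _≟HC2_

  record IsHopfIso : Set (c ⊔ ℓ) where
    field
      well-defined : ∀ x y → x ≋Ce y → Υ x ≋HC Υ y
      additive     : ∀ x y → Υ (x ++ y) ≋HC (Υ x ++ Υ y)
      homogeneous  : ∀ k x → Υ (scale k x) ≋HC scale k (Υ x)
      inverse      : Lin HCBasis → Lin ExtComp
      inverse-wd   : ∀ x y → x ≋HC y → inverse x ≋Ce inverse y
      left-inv     : ∀ x → inverse (Υ x) ≋Ce x
      right-inv    : ∀ y → Υ (inverse y) ≋HC y
      pres-mul     : ∀ x y → Υ (mulCe x y) ≋HC mulHC (Υ x) (Υ y)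
      pres-unit    : Υ unitCe ≋HC unitHC
      pres-Δ       : ∀ x → ΔHC (Υ x) ≋HC² (ΥB ⊗ₘ ΥB) (ΔCe x)
      pres-ε       : ∀ x → εHC (Υ x) ≈ εCe x

module Submission where

-- Υ is the identity on the common basis ℕ × (words in ℕ*), so linearity, bijectivity and
-- compatibility with product, unit and counit are immediate; the content is the coproduct.
-- Formal sums are compared through their pairings εL φ with arbitrary functionals φ.
-- Paired with φ, Δ̄((h) ⊗ w) factors into Δ_H((1)^h) = Σ_a binom(h,a) (a) ⊗ (h-a) (the
-- binomial theorem, via Pascal's rule), which supplies the first entry a of the left factor,
-- and (ρ ⊗ id) ∘ Δ_C, which sends each letter α of w either to the right factor or, split by
-- ρ, to the left as (0,k) ⊗ (α-k) with 1 ≤ k ≤ α and coefficient binom(α,k). Multiplying the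
-- (α-k) into the H-part of the right factor gives exactly the terms of Δ on 𝒞_e.

open import Defs
open import Algebra.Bundles using (CommutativeRing)
import Algebra.Properties.CommutativeSemigroup as CommSemigroupProperties
import Algebra.Properties.Semiring.Sum as SemiringSum
open import Data.Nat using (ℕ; zero; suc; _+_; _∸_; _<_)
open import Data.Nat.Properties using (n<1+n; n∸n≡0; +-∸-assoc)
open import Data.Nat.Combinatorics using (_C_; nCk+nC[k+1]≡[n+1]C[k+1]; k>n⇒nCk≡0; nCn≡1)
open import Data.Fin using (toℕ)
open import Data.Fin.Properties using (toℕ<n; toℕ-fromℕ; toℕ-inject₁)
open import Data.List using (List; []; _∷_; _++_; map; concatMap; applyUpTo; upTo)
open import Function using (_∘_)
open import Data.Product using (_×_; _,_; proj₁; proj₂)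
open import Data.Bool using (if_then_else_; true; false)
open import Relation.Nullary using (does)
open import Relation.Binary.Definitions using (DecidableEquality)
open import Relation.Binary.PropositionalEquality as ≡ using (cong)

module _ {c ℓ} (F : CharZeroField c ℓ) where
  open CharZeroField F
  open CommutativeRing commRing renaming (_+_ to _+ᴷ_; _*_ to _*ᴷ_)
  open Over F
  open SemiringSum semiring using (sum-syntax; sum-cong-≋; sum-init-last; ∑-distrib-+)
  open CommSemigroupProperties +-commutativeSemigroup
    using (interchange) renaming (x∙yz≈y∙xz to +-x∙yz≈y∙xz)
  open CommSemigroupProperties *-commutativeSemigroup
    using () renaming (x∙yz≈y∙xz to *-x∙yz≈y∙xz)
  open import Relation.Binary.Reasoning.Setoid setoid

  private variable
    A B D : Set

  εL-cong : ∀ {φ ψ : B → K} → (∀ b → φ b ≈ ψ b) → ∀ x → εL φ x ≈ εL ψ x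
  εL-cong e []            = refl
  εL-cong e ((k , b) ∷ x) = +-cong (*-congˡ (e b)) (εL-cong e x)

  εL-ret : ∀ (φ : B → K) b → εL φ (ret b) ≈ φ b
  εL-ret φ b = trans (+-identityʳ _) (*-identityˡ _)

  εL-++ : ∀ (φ : B → K) x y → εL φ (x ++ y) ≈ εL φ x +ᴷ εL φ y
  εL-++ φ []            y = sym (+-identityˡ _)
  εL-++ φ ((k , b) ∷ x) y = trans (+-congˡ (εL-++ φ x y)) (sym (+-assoc _ _ _))

  εL-scale : ∀ (φ : B → K) k x → εL φ (scale k x) ≈ k *ᴷ εL φ x
  εL-scale φ k []            = sym (zeroʳ k)
  εL-scale φ k ((d , b) ∷ x) =
    trans (+-cong (*-assoc _ _ _) (εL-scale φ k x)) (sym (distribˡ _ _ _))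

  εL-ext : ∀ (φ : B → K) (f : A → Lin B) x → εL φ (ext f x) ≈ εL (λ a → εL φ (f a)) x
  εL-ext φ f []            = refl
  εL-ext φ f ((k , a) ∷ x) =
    trans (εL-++ φ (scale k (f a)) (ext f x)) (+-cong (εL-scale φ k (f a)) (εL-ext φ f x))

  εL-bilin : ∀ (φ : D → K) (f : A → B → Lin D) x y →
             εL φ (bilin f x y) ≈ εL (λ a → εL (λ b → εL φ (f a b)) y) x
  εL-bilin φ f x y = trans (εL-ext φ _ x) (εL-cong (λ a → εL-ext φ (f a) y) x)

  εL-+ : ∀ (φ ψ : B → K) x → εL (λ b → φ b +ᴷ ψ b) x ≈ εL φ x +ᴷ εL ψ x
  εL-+ φ ψ []            = sym (+-identityˡ _)
  εL-+ φ ψ ((k , b) ∷ x) =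
    trans (+-cong (distribˡ k (φ b) (ψ b)) (εL-+ φ ψ x)) (interchange _ _ _ _)

  εL-*ˡ : ∀ d (φ : B → K) x → εL (λ b → d *ᴷ φ b) x ≈ d *ᴷ εL φ x
  εL-*ˡ d φ []            = sym (zeroʳ d)
  εL-*ˡ d φ ((k , b) ∷ x) =
    trans (+-cong (*-x∙yz≈y∙xz k d (φ b)) (εL-*ˡ d φ x)) (sym (distribˡ _ _ _))

  εL-0 : ∀ (x : Lin B) → εL (λ _ → 0#) x ≈ 0#
  εL-0 []            = refl
  εL-0 ((k , b) ∷ x) = trans (+-cong (zeroʳ k) (εL-0 x)) (+-identityˡ 0#)

  εL-map : ∀ (φ : B → K) (t : A → B) x →
           εL φ (map (λ { (k , a) → (k , t a) }) x) ≈ εL (λ a → φ (t a)) x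
  εL-map φ t []            = refl
  εL-map φ t ((k , a) ∷ x) = +-congˡ (εL-map φ t x)

  εL-map-scale : ∀ (φ : B → K) d (t : A → B) x →
                 εL φ (map (λ { (k , a) → (d *ᴷ k , t a) }) x) ≈ d *ᴷ εL (λ a → φ (t a)) x
  εL-map-scale φ d t []            = sym (zeroʳ d)
  εL-map-scale φ d t ((k , a) ∷ x) =
    trans (+-cong (*-assoc _ _ _) (εL-map-scale φ d t x)) (sym (distribˡ _ _ _))

  indicator : DecidableEquality B → B → B → K
  indicator _≟_ b a = if does (a ≟ b) then 1# else 0#

  coeff≈εL-indicator : ∀ (_≟_ : DecidableEquality B) x b → coeff _≟_ x b ≈ εL (indicator _≟_ b) x
  coeff≈εL-indicator _≟_ []            b = refl
  coeff≈εL-indicator _≟_ ((k , a) ∷ x) b with does (a ≟ b)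
  ... | true  = +-cong (sym (*-identityʳ k)) (coeff≈εL-indicator _≟_ x b)
  ... | false = trans (coeff≈εL-indicator _≟_ x b) (sym (trans (+-congʳ (zeroʳ k)) (+-identityˡ _)))

  Eq-by-εL : ∀ (_≟_ : DecidableEquality B) x y → (∀ φ → εL φ x ≈ εL φ y) → Eq _≟_ x y
  Eq-by-εL _≟_ x y εLx≈εLy b = begin
    coeff _≟_ x b               ≈⟨ coeff≈εL-indicator _≟_ x b ⟩
    εL (indicator _≟_ b) x      ≈⟨ εLx≈εLy (indicator _≟_ b) ⟩
    εL (indicator _≟_ b) y      ≈⟨ coeff≈εL-indicator _≟_ y b ⟨
    coeff _≟_ y b               ∎

  εL-Υ : ∀ (φ : HCBasis → K) x → εL φ (Υ x) ≈ εL φ x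
  εL-Υ φ x = trans (εL-ext φ ΥB x) (εL-cong (εL-ret φ) x)

  εL-Υ⊗Υ : ∀ (φ : HCBasis × HCBasis → K) z → εL φ ((ΥB ⊗ₘ ΥB) z) ≈ εL φ z
  εL-Υ⊗Υ φ z = trans (εL-ext φ tensor z) (εL-cong (λ { (a , b) → pair a b }) z)
    where
    tensor : HCBasis × HCBasis → Lin (HCBasis × HCBasis)
    tensor (a , b) = bilin (λ a' b' → ret (a' , b')) (ΥB a) (ΥB b)
    pair : ∀ a b → εL φ (tensor (a , b)) ≈ φ (a , b)
    pair a b = begin
      εL φ (tensor (a , b))
        ≈⟨ εL-bilin φ (λ a' b' → ret (a' , b')) (ret a) (ret b) ⟩
      εL (λ a' → εL (λ b' → εL φ (ret (a' , b'))) (ret b)) (ret a)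
        ≈⟨ εL-ret (λ a' → εL (λ b' → εL φ (ret (a' , b'))) (ret b)) a ⟩
      εL (λ b' → εL φ (ret (a , b'))) (ret b)
        ≈⟨ εL-ret (λ b' → εL φ (ret (a , b'))) b ⟩
      εL φ (ret (a , b))
        ≈⟨ εL-ret φ (a , b) ⟩
      φ (a , b)
        ∎

  -- Opaque so that the summand of a sumUpTo is recovered by unification.
  opaque
    sumUpTo : ℕ → (ℕ → K) → K
    sumUpTo n w = ∑[ i < n ] w (toℕ i)

    sumUpTo-zero : ∀ (w : ℕ → K) → sumUpTo 0 w ≈ 0#
    sumUpTo-zero w = refl

    sumUpTo-suc : ∀ n (w : ℕ → K) → sumUpTo (suc n) w ≈ w 0 +ᴷ sumUpTo n (λ i → w (suc i))
    sumUpTo-suc n w = refl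

    sumUpTo-cong : ∀ n {w v : ℕ → K} → (∀ i → i < n → w i ≈ v i) → sumUpTo n w ≈ sumUpTo n v
    sumUpTo-cong n w≈v = sum-cong-≋ (λ i → w≈v (toℕ i) (toℕ<n i))

    sumUpTo-+ : ∀ n (w v : ℕ → K) → sumUpTo n (λ i → w i +ᴷ v i) ≈ sumUpTo n w +ᴷ sumUpTo n v
    sumUpTo-+ n w v = ∑-distrib-+ {n} (λ i → w (toℕ i)) (λ i → v (toℕ i))

    sumUpTo-last : ∀ n (w : ℕ → K) → sumUpTo (suc n) w ≈ sumUpTo n w +ᴷ w n
    sumUpTo-last n w = trans (sum-init-last {n} (λ i → w (toℕ i)))
      (+-cong (sum-cong-≋ {n} (λ i → reflexive (cong w (toℕ-inject₁ i))))
              (reflexive (cong w (toℕ-fromℕ n))))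

    εL-sumUpTo : ∀ n (w : ℕ → B → K) x →
                 εL (λ b → sumUpTo n (λ j → w j b)) x ≈ sumUpTo n (λ j → εL (w j) x)
    εL-sumUpTo zero    w x = εL-0 x
    εL-sumUpTo (suc n) w x = trans (εL-+ (w 0) _ x) (+-congˡ (εL-sumUpTo n (λ j → w (suc j)) x))

  εL-concatMap-applyUpTo : ∀ (φ : B → K) (g : A → Lin B) (f : ℕ → A) n →
    εL φ (concatMap g (applyUpTo f n)) ≈ sumUpTo n (λ i → εL φ (g (f i)))
  εL-concatMap-applyUpTo φ g f zero    = sym (sumUpTo-zero _)
  εL-concatMap-applyUpTo φ g f (suc n) = begin
    εL φ (g (f 0) ++ concatMap g (applyUpTo (λ i → f (suc i)) n))
      ≈⟨ εL-++ φ (g (f 0)) _ ⟩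
    εL φ (g (f 0)) +ᴷ εL φ (concatMap g (applyUpTo (λ i → f (suc i)) n))
      ≈⟨ +-congˡ (εL-concatMap-applyUpTo φ g (λ i → f (suc i)) n) ⟩
    εL φ (g (f 0)) +ᴷ sumUpTo n (λ i → εL φ (g (f (suc i))))
      ≈⟨ sumUpTo-suc n _ ⟨
    sumUpTo (suc n) (λ i → εL φ (g (f i)))
      ∎

  εL-map-applyUpTo : ∀ (φ : B → K) (t : A → K × B) (f : ℕ → A) n →
    εL φ (map t (applyUpTo f n)) ≈ sumUpTo n (λ i → proj₁ (t (f i)) *ᴷ φ (proj₂ (t (f i))))
  εL-map-applyUpTo φ t f zero    = sym (sumUpTo-zero _)
  εL-map-applyUpTo φ t f (suc n) =
    trans (+-congˡ (εL-map-applyUpTo φ t (λ i → f (suc i)) n)) (sym (sumUpTo-suc n _))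

  fromℕ-+ : ∀ m n → ⟦ m + n ⟧ ≈ ⟦ m ⟧ +ᴷ ⟦ n ⟧
  fromℕ-+ zero    n = sym (+-identityˡ _)
  fromℕ-+ (suc m) n = trans (+-congˡ (fromℕ-+ m n)) (sym (+-assoc _ _ _))

  binomialSum : ℕ → (ℕ × ℕ → K) → K
  binomialSum h χ = sumUpTo (suc h) (λ a → ⟦ h C a ⟧ *ᴷ χ (a , h ∸ a))

  binomialSum-pascal : ∀ m (χ : ℕ × ℕ → K) →
    binomialSum (suc m) χ ≈
      binomialSum m (λ { (a , b) → χ (suc a , b) }) +ᴷ binomialSum m (λ { (a , b) → χ (a , suc b) })
  binomialSum-pascal m χ = begin
    binomialSum (suc m) χ
      ≈⟨ sumUpTo-suc (suc m) _ ⟩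
    χ₀ +ᴷ sumUpTo (suc m) (λ i → ⟦ suc m C suc i ⟧ *ᴷ g i)
      ≈⟨ +-congˡ (sumUpTo-cong (suc m) (λ i _ → split i)) ⟩
    χ₀ +ᴷ sumUpTo (suc m) (λ i → ⟦ m C i ⟧ *ᴷ g i +ᴷ ⟦ m C suc i ⟧ *ᴷ g i)
      ≈⟨ +-congˡ (sumUpTo-+ (suc m) _ _) ⟩
    χ₀ +ᴷ (left +ᴷ sumUpTo (suc m) (λ i → ⟦ m C suc i ⟧ *ᴷ g i))
      ≈⟨ +-congˡ (+-congˡ dropLast) ⟩
    χ₀ +ᴷ (left +ᴷ sumUpTo m (λ i → ⟦ m C suc i ⟧ *ᴷ g i))
      ≈⟨ +-x∙yz≈y∙xz _ _ _ ⟩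
    left +ᴷ (χ₀ +ᴷ sumUpTo m (λ i → ⟦ m C suc i ⟧ *ᴷ g i))
      ≈⟨ +-congˡ (+-congˡ (sumUpTo-cong m (λ i i<m →
           *-congˡ (reflexive (cong (λ b → χ (suc i , b)) (+-∸-assoc 1 i<m)))))) ⟩
    left +ᴷ (χ₀ +ᴷ sumUpTo m (λ i → ⟦ m C suc i ⟧ *ᴷ χ (suc i , suc (m ∸ suc i))))
      ≈⟨ +-congˡ (sumUpTo-suc m _) ⟨
    left +ᴷ binomialSum m (λ { (a , b) → χ (a , suc b) })
      ∎
    where
    χ₀ = ⟦ suc m C 0 ⟧ *ᴷ χ (0 , suc m)
    g : ℕ → K
    g i = χ (suc i , m ∸ i)
    left = binomialSum m (λ { (a , b) → χ (suc a , b) })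
    split : ∀ i → ⟦ suc m C suc i ⟧ *ᴷ g i ≈ ⟦ m C i ⟧ *ᴷ g i +ᴷ ⟦ m C suc i ⟧ *ᴷ g i
    split i = trans (*-congʳ (trans (reflexive (cong ⟦_⟧ (≡.sym (nCk+nC[k+1]≡[n+1]C[k+1] m i))))
                                    (fromℕ-+ (m C i) (m C suc i))))
                    (distribʳ (g i) _ _)
    dropLast : sumUpTo (suc m) (λ i → ⟦ m C suc i ⟧ *ᴷ g i) ≈ sumUpTo m (λ i → ⟦ m C suc i ⟧ *ᴷ g i)
    dropLast = begin
      sumUpTo (suc m) (λ i → ⟦ m C suc i ⟧ *ᴷ g i)      ≈⟨ sumUpTo-last m _ ⟩
      sumUpTo m (λ i → ⟦ m C suc i ⟧ *ᴷ g i) +ᴷ ⟦ m C suc m ⟧ *ᴷ g m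
        ≈⟨ +-congˡ (trans (*-congʳ (reflexive (cong ⟦_⟧ (k>n⇒nCk≡0 (n<1+n m))))) (zeroˡ _)) ⟩
      sumUpTo m (λ i → ⟦ m C suc i ⟧ *ᴷ g i) +ᴷ 0#       ≈⟨ +-identityʳ _ ⟩
      sumUpTo m (λ i → ⟦ m C suc i ⟧ *ᴷ g i)             ∎

  ΔH-binomial : ∀ h (χ : ℕ × ℕ → K) → εL χ (ΔHB h) ≈ binomialSum h χ
  ΔH-binomial zero    χ = begin
    εL χ (ret (0 , 0))                                ≈⟨ εL-ret χ (0 , 0) ⟩
    χ (0 , 0)                                         ≈⟨ *-identityˡ _ ⟨
    1# *ᴷ χ (0 , 0)                                   ≈⟨ *-congʳ (+-identityʳ 1#) ⟨
    ⟦ 0 C 0 ⟧ *ᴷ χ (0 , 0)                            ≈⟨ +-identityʳ _ ⟨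
    ⟦ 0 C 0 ⟧ *ᴷ χ (0 , 0) +ᴷ 0#                      ≈⟨ +-congˡ (sumUpTo-zero _) ⟨
    ⟦ 0 C 0 ⟧ *ᴷ χ (0 , 0) +ᴷ sumUpTo 0 (λ a → ⟦ 0 C suc a ⟧ *ᴷ χ (suc a , 0 ∸ suc a))
                                                      ≈⟨ sumUpTo-suc 0 _ ⟨
    binomialSum 0 χ                                   ∎
  ΔH-binomial (suc m) χ = begin
    εL χ (ΔHB (suc m))
      ≈⟨ εL-bilin χ mulHHB (ret (1 , 0) ++ ret (0 , 1)) (ΔHB m) ⟩
    εL shifted (ret (1 , 0) ++ ret (0 , 1))
      ≈⟨ εL-++ shifted (ret (1 , 0)) (ret (0 , 1)) ⟩
    εL shifted (ret (1 , 0)) +ᴷ εL shifted (ret (0 , 1))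
      ≈⟨ +-cong (εL-ret shifted (1 , 0)) (εL-ret shifted (0 , 1)) ⟩
    shifted (1 , 0) +ᴷ shifted (0 , 1)
      ≈⟨ +-cong (trans (εL-cong (λ ab → εL-ret χ _) (ΔHB m)) (ΔH-binomial m _))
                (trans (εL-cong (λ ab → εL-ret χ _) (ΔHB m)) (ΔH-binomial m _)) ⟩
    binomialSum m (λ { (a , b) → χ (suc a , b) }) +ᴷ binomialSum m (λ { (a , b) → χ (a , suc b) })
      ≈⟨ binomialSum-pascal m χ ⟨
    binomialSum (suc m) χ
      ∎
    where
    shifted : ℕ × ℕ → K
    shifted a = εL (λ b → εL χ (mulHHB a b)) (ΔHB m)

  Selection : Set
  Selection = List ℕ* × ℕ × List ℕ*

  -- ψ ∘ (ρ ⊗ id) as a functional on C ⊗ C, with C ⊗ H ⊗ C laid out as Selection.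
  pullρ : (Selection → K) → CBasis × CBasis → K
  pullρ ψ (c' , c'') = εL (λ { (x , y) → ψ (x , y , c'') }) (ρB c')

  unselected : ℕ* → (Selection → K) → Selection → K
  unselected α ψ (ks , e , us) = ψ (ks , e , α ∷ us)

  selected : ℕ → ℕ → (Selection → K) → Selection → K
  selected m j ψ (ks , e , us) = ψ (1+ j ∷ ks , (m ∸ j) + e , us)

  binom⁺ : ℕ → ℕ → K
  binom⁺ m j = ⟦ suc m C suc j ⟧

  selections-∷ : ∀ (ψ : Selection → K) m w →
    εL ψ (selections (1+ m ∷ w)) ≈
      εL (unselected (1+ m) ψ) (selections w)
      +ᴷ sumUpTo (suc m) (λ j → binom⁺ m j *ᴷ εL (selected m j ψ) (selections w))
  selections-∷ ψ m w =
    trans (εL-++ ψ (map (λ { (k , s) → (k , skip s) }) (selections w)) _)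
      (+-cong (εL-map ψ skip (selections w))
        (trans (εL-concatMap-applyUpTo ψ
                  (λ j → map (λ { (k , s) → (binom⁺ m j *ᴷ k , take j s) }) (selections w)) (λ j → j) (suc m))
          (sumUpTo-cong (suc m) (λ j _ → εL-map-scale ψ (binom⁺ m j) (take j) (selections w)))))
    where
    skip : Selection → Selection
    skip (ks , e , us) = (ks , e , 1+ m ∷ us)
    take : ℕ → Selection → Selection
    take j (ks , e , us) = (1+ j ∷ ks , (m ∸ j) + e , us)

  εL-ρletter : ∀ (θ : CBasis × HBasis → K) m →
    εL θ (ρletter (1+ m)) ≈ sumUpTo (suc m) (λ j → binom⁺ m j *ᴷ θ (1+ j ∷ [] , m ∸ j))
  εL-ρletter θ m = begin
    εL θ (map term (upTo m) ++ ret (1+ m ∷ [] , 0))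
      ≈⟨ εL-++ θ (map term (upTo m)) _ ⟩
    εL θ (map term (upTo m)) +ᴷ εL θ (ret (1+ m ∷ [] , 0))
      ≈⟨ +-cong (εL-map-applyUpTo θ term (λ j → j) m) (εL-ret θ _) ⟩
    sumUpTo m (λ j → binom⁺ m j *ᴷ θ (1+ j ∷ [] , m ∸ j)) +ᴷ θ (1+ m ∷ [] , 0)
      ≈⟨ +-congˡ lastTerm ⟨
    sumUpTo m (λ j → binom⁺ m j *ᴷ θ (1+ j ∷ [] , m ∸ j)) +ᴷ binom⁺ m m *ᴷ θ (1+ m ∷ [] , m ∸ m)
      ≈⟨ sumUpTo-last m _ ⟨
    sumUpTo (suc m) (λ j → binom⁺ m j *ᴷ θ (1+ j ∷ [] , m ∸ j))
      ∎
    where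
    term : ℕ → K × (CBasis × HBasis)
    term j = (binom⁺ m j , (1+ j ∷ [] , m ∸ j))
    lastTerm : binom⁺ m m *ᴷ θ (1+ m ∷ [] , m ∸ m) ≈ θ (1+ m ∷ [] , 0)
    lastTerm = trans (*-cong (trans (reflexive (cong ⟦_⟧ (nCn≡1 (suc m)))) (+-identityʳ 1#))
                             (reflexive (cong (λ h → θ (1+ m ∷ [] , h)) (n∸n≡0 m))))
                     (*-identityˡ _)

  pullρ-∷ : ∀ (ψ : Selection → K) m c' c'' →
    pullρ ψ (1+ m ∷ c' , c'') ≈ sumUpTo (suc m) (λ j → binom⁺ m j *ᴷ pullρ (selected m j ψ) (c' , c''))
  pullρ-∷ ψ m c' c'' =
    trans (εL-bilin ψ'' mulCHB (ρletter (1+ m)) (ρB c'))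
      (trans (εL-ρletter (λ l → εL (λ r → εL ψ'' (mulCHB l r)) (ρB c')) m)
        (sumUpTo-cong (suc m) (λ j _ →
          *-congˡ (εL-cong (λ { (x , y) → εL-ret ψ'' (1+ j ∷ x , (m ∸ j) + y) }) (ρB c')))))
    where
    ψ'' : CBasis × HBasis → K
    ψ'' (x , y) = ψ (x , y , c'')

  ρ⊗id∘ΔC≈selections : ∀ (ψ : Selection → K) c → εL (pullρ ψ) (ΔCB c) ≈ εL ψ (selections c)
  ρ⊗id∘ΔC≈selections ψ [] =
    trans (εL-ret (pullρ ψ) ([] , [])) (trans (εL-ret (λ { (x , y) → ψ (x , y , []) }) ([] , 0))
                                             (sym (εL-ret ψ ([] , 0 , []))))
  ρ⊗id∘ΔC≈selections ψ (1+ m ∷ w) = begin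
    εL (pullρ ψ) (bilin mulCCB (ret (α ∷ [] , []) ++ ret ([] , α ∷ [])) (ΔCB w))
      ≈⟨ εL-bilin (pullρ ψ) mulCCB (ret (α ∷ [] , []) ++ ret ([] , α ∷ [])) (ΔCB w) ⟩
    εL sent (ret (α ∷ [] , []) ++ ret ([] , α ∷ []))
      ≈⟨ εL-++ sent (ret (α ∷ [] , [])) (ret ([] , α ∷ [])) ⟩
    εL sent (ret (α ∷ [] , [])) +ᴷ εL sent (ret ([] , α ∷ []))
      ≈⟨ +-cong (εL-ret sent (α ∷ [] , [])) (εL-ret sent ([] , α ∷ [])) ⟩
    sent (α ∷ [] , []) +ᴷ sent ([] , α ∷ [])
      ≈⟨ +-comm _ _ ⟩
    sent ([] , α ∷ []) +ᴷ sent (α ∷ [] , [])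
      ≈⟨ +-cong toRight toLeft ⟩
    εL (unselected α ψ) (selections w)
      +ᴷ sumUpTo (suc m) (λ j → binom⁺ m j *ᴷ εL (selected m j ψ) (selections w))
      ≈⟨ selections-∷ ψ m w ⟨
    εL ψ (selections (α ∷ w))
      ∎
    where
    α = 1+ m
    sent : CBasis × CBasis → K
    sent a = εL (λ b → εL (pullρ ψ) (mulCCB a b)) (ΔCB w)
    toRight : sent ([] , α ∷ []) ≈ εL (unselected α ψ) (selections w)
    toRight = trans (εL-cong (λ { (c' , c'') → εL-ret (pullρ ψ) (c' , α ∷ c'') }) (ΔCB w))
                    (ρ⊗id∘ΔC≈selections (unselected α ψ) w)
    toLeft : sent (α ∷ [] , []) ≈
             sumUpTo (suc m) (λ j → binom⁺ m j *ᴷ εL (selected m j ψ) (selections w))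
    toLeft = begin
      sent (α ∷ [] , [])
        ≈⟨ εL-cong (λ { (c' , c'') → trans (εL-ret (pullρ ψ) (α ∷ c' , c'')) (pullρ-∷ ψ m c' c'') })
                   (ΔCB w) ⟩
      εL (λ p → sumUpTo (suc m) (λ j → binom⁺ m j *ᴷ pullρ (selected m j ψ) p)) (ΔCB w)
        ≈⟨ εL-sumUpTo (suc m) (λ j p → binom⁺ m j *ᴷ pullρ (selected m j ψ) p) (ΔCB w) ⟩
      sumUpTo (suc m) (λ j → εL (λ p → binom⁺ m j *ᴷ pullρ (selected m j ψ) p) (ΔCB w))
        ≈⟨ sumUpTo-cong (suc m) (λ j _ → trans (εL-*ˡ (binom⁺ m j) (pullρ (selected m j ψ)) (ΔCB w))
                                               (*-congˡ (ρ⊗id∘ΔC≈selections (selected m j ψ) w))) ⟩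
      sumUpTo (suc m) (λ j → binom⁺ m j *ᴷ εL (selected m j ψ) (selections w))
        ∎

  splitTerm : ℕ → ℕ → Selection → HCBasis × HCBasis
  splitTerm h a (ks , e , us) = ((a , ks) , ((h ∸ a) + e , us))

  εL-ΔCeB : ∀ (φ : HCBasis × HCBasis → K) h c →
    εL φ (ΔCeB (h , c)) ≈ sumUpTo (suc h) (λ a → ⟦ h C a ⟧ *ᴷ εL (φ ∘ splitTerm h a) (selections c))
  εL-ΔCeB φ h c =
    trans (εL-concatMap-applyUpTo φ
             (λ a → map (λ { (k , s) → (⟦ h C a ⟧ *ᴷ k , splitTerm h a s) }) (selections c))
             (λ a → a) (suc h))
      (sumUpTo-cong (suc h) (λ a _ → εL-map-scale φ ⟦ h C a ⟧ (splitTerm h a) (selections c)))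

  εL-ΔHCB : ∀ (φ : HCBasis × HCBasis → K) h c →
    εL φ (ΔHCB (h , c)) ≈
      εL (λ p → sumUpTo (suc h) (λ a → ⟦ h C a ⟧ *ᴷ pullρ (φ ∘ splitTerm h a) p)) (ΔCB c)
  εL-ΔHCB φ h c = trans (εL-ext φ (λ { (c' , c'') → ext (ρPart c'') (ρB c') }) (ΔCB c))
                        (εL-cong (λ { (c' , c'') → perCoproductTerm c' c'' }) (ΔCB c))
    where
    hPart : CBasis → HBasis → CBasis → HBasis × HBasis → Lin (HCBasis × HCBasis)
    hPart c'₁ c'₂ c'' (h₁ , h₂) = ext (λ z → ret ((h₁ , c'₁) , (z , c''))) (mulHB h₂ c'₂)
    ρPart : CBasis → CBasis × HBasis → Lin (HCBasis × HCBasis)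
    ρPart c'' (c'₁ , c'₂) = ext (hPart c'₁ c'₂ c'') (ΔHB h)
    hPart-term : ∀ c'₁ c'₂ c'' h₁ h₂ →
                 εL φ (hPart c'₁ c'₂ c'' (h₁ , h₂)) ≈ φ ((h₁ , c'₁) , (h₂ + c'₂ , c''))
    hPart-term c'₁ c'₂ c'' h₁ h₂ =
      trans (εL-ext φ (λ z → ret ((h₁ , c'₁) , (z , c''))) (ret (h₂ + c'₂)))
            (trans (εL-ret (λ z → εL φ (ret ((h₁ , c'₁) , (z , c'')))) (h₂ + c'₂)) (εL-ret φ _))
    term : CBasis → ℕ → CBasis × HBasis → K
    term c'' a (c'₁ , c'₂) = ⟦ h C a ⟧ *ᴷ φ (splitTerm h a (c'₁ , c'₂ , c''))
    ρPart-binomial : ∀ c'' q → εL φ (ρPart c'' q) ≈ sumUpTo (suc h) (λ a → term c'' a q)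
    ρPart-binomial c'' (c'₁ , c'₂) =
      trans (εL-ext φ (hPart c'₁ c'₂ c'') (ΔHB h))
        (trans (εL-cong (λ { (h₁ , h₂) → hPart-term c'₁ c'₂ c'' h₁ h₂ }) (ΔHB h))
               (ΔH-binomial h (λ { (h₁ , h₂) → φ ((h₁ , c'₁) , (h₂ + c'₂ , c'')) })))
    perCoproductTerm : ∀ c' c'' →
      εL φ (ext (ρPart c'') (ρB c')) ≈
        sumUpTo (suc h) (λ a → ⟦ h C a ⟧ *ᴷ pullρ (φ ∘ splitTerm h a) (c' , c''))
    perCoproductTerm c' c'' = begin
      εL φ (ext (ρPart c'') (ρB c'))
        ≈⟨ εL-ext φ (ρPart c'') (ρB c') ⟩
      εL (λ q → εL φ (ρPart c'' q)) (ρB c')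
        ≈⟨ εL-cong (ρPart-binomial c'') (ρB c') ⟩
      εL (λ q → sumUpTo (suc h) (λ a → term c'' a q)) (ρB c')
        ≈⟨ εL-sumUpTo (suc h) (term c'') (ρB c') ⟩
      sumUpTo (suc h) (λ a → εL (term c'' a) (ρB c'))
        ≈⟨ sumUpTo-cong (suc h) (λ a _ →
             εL-*ˡ ⟦ h C a ⟧ (λ q → φ (splitTerm h a (proj₁ q , proj₂ q , c''))) (ρB c')) ⟩
      sumUpTo (suc h) (λ a → ⟦ h C a ⟧ *ᴷ pullρ (φ ∘ splitTerm h a) (c' , c''))
        ∎

  εL-ΔHCB≈εL-ΔCeB : ∀ (φ : HCBasis × HCBasis → K) a → εL φ (ΔHCB a) ≈ εL φ (ΔCeB a)
  εL-ΔHCB≈εL-ΔCeB φ (h , c) = begin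
    εL φ (ΔHCB (h , c))
      ≈⟨ εL-ΔHCB φ h c ⟩
    εL (λ p → sumUpTo (suc h) (λ a → ⟦ h C a ⟧ *ᴷ pullρ (φ ∘ splitTerm h a) p)) (ΔCB c)
      ≈⟨ εL-sumUpTo (suc h) (λ a p → ⟦ h C a ⟧ *ᴷ pullρ (φ ∘ splitTerm h a) p) (ΔCB c) ⟩
    sumUpTo (suc h) (λ a → εL (λ p → ⟦ h C a ⟧ *ᴷ pullρ (φ ∘ splitTerm h a) p) (ΔCB c))
      ≈⟨ sumUpTo-cong (suc h) (λ a _ → trans (εL-*ˡ ⟦ h C a ⟧ (pullρ (φ ∘ splitTerm h a)) (ΔCB c))
                                            (*-congˡ (ρ⊗id∘ΔC≈selections (φ ∘ splitTerm h a) c))) ⟩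
    sumUpTo (suc h) (λ a → ⟦ h C a ⟧ *ᴷ εL (φ ∘ splitTerm h a) (selections c))
      ≈⟨ εL-ΔCeB φ h c ⟨
    εL φ (ΔCeB (h , c))
      ∎

  coeff-Υ : ∀ x b → coeff _≟E_ (Υ x) b ≈ coeff _≟E_ x b
  coeff-Υ x b = begin
    coeff _≟E_ (Υ x) b            ≈⟨ coeff≈εL-indicator _≟E_ (Υ x) b ⟩
    εL (indicator _≟E_ b) (Υ x)   ≈⟨ εL-Υ (indicator _≟E_ b) x ⟩
    εL (indicator _≟E_ b) x       ≈⟨ coeff≈εL-indicator _≟E_ x b ⟨
    coeff _≟E_ x b                ∎

  εL-Υ-mulCe : ∀ (φ : HCBasis → K) x y → εL φ (Υ (mulCe x y)) ≈ εL φ (mulHC (Υ x) (Υ y))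
  εL-Υ-mulCe φ x y = begin
    εL φ (Υ (mulCe x y))                                         ≈⟨ εL-Υ φ (mulCe x y) ⟩
    εL φ (mulCe x y)                                             ≈⟨ εL-bilin φ mulCeB x y ⟩
    εL (λ a → εL (λ b → εL φ (mulHCB a b)) y) x                  ≈⟨ εL-cong (λ a → εL-Υ _ y) x ⟨
    εL (λ a → εL (λ b → εL φ (mulHCB a b)) (Υ y)) x              ≈⟨ εL-Υ _ x ⟨
    εL (λ a → εL (λ b → εL φ (mulHCB a b)) (Υ y)) (Υ x)          ≈⟨ εL-bilin φ mulHCB (Υ x) (Υ y) ⟨
    εL φ (mulHC (Υ x) (Υ y))                                     ∎

  εL-ΔHC-Υ : ∀ (φ : HCBasis × HCBasis → K) x → εL φ (ΔHC (Υ x)) ≈ εL φ ((ΥB ⊗ₘ ΥB) (ΔCe x))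
  εL-ΔHC-Υ φ x = begin
    εL φ (ΔHC (Υ x))                      ≈⟨ εL-ext φ ΔHCB (Υ x) ⟩
    εL (λ a → εL φ (ΔHCB a)) (Υ x)        ≈⟨ εL-Υ _ x ⟩
    εL (λ a → εL φ (ΔHCB a)) x            ≈⟨ εL-cong (εL-ΔHCB≈εL-ΔCeB φ) x ⟩
    εL (λ a → εL φ (ΔCeB a)) x            ≈⟨ εL-ext φ ΔCeB x ⟨
    εL φ (ΔCe x)                          ≈⟨ εL-Υ⊗Υ φ (ΔCe x) ⟨
    εL φ ((ΥB ⊗ₘ ΥB) (ΔCe x))             ∎

  εHCB≈εCeB : ∀ a → εHCB a ≈ εCeB a
  εHCB≈εCeB (zero  , [])    = *-identityˡ 1#
  εHCB≈εCeB (zero  , _ ∷ _) = zeroʳ 1#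
  εHCB≈εCeB (suc _ , _)     = zeroˡ _

  Υ-isHopfIso : IsHopfIso
  Υ-isHopfIso = record
    { well-defined = λ x y x≋y b → trans (coeff-Υ x b) (trans (x≋y b) (sym (coeff-Υ y b)))
    ; additive     = λ x y → Eq-by-εL _≟E_ (Υ (x ++ y)) (Υ x ++ Υ y) λ φ →
        trans (εL-Υ φ (x ++ y)) (trans (εL-++ φ x y)
          (sym (trans (εL-++ φ (Υ x) (Υ y)) (+-cong (εL-Υ φ x) (εL-Υ φ y)))))
    ; homogeneous  = λ k x → Eq-by-εL _≟E_ (Υ (scale k x)) (scale k (Υ x)) λ φ →
        trans (εL-Υ φ (scale k x)) (trans (εL-scale φ k x)
          (sym (trans (εL-scale φ k (Υ x)) (*-congˡ (εL-Υ φ x)))))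
    ; inverse      = λ y → y
    ; inverse-wd   = λ x y x≋y → x≋y
    ; left-inv     = coeff-Υ
    ; right-inv    = coeff-Υ
    ; pres-mul     = λ x y → Eq-by-εL _≟E_ (Υ (mulCe x y)) (mulHC (Υ x) (Υ y)) (λ φ → εL-Υ-mulCe φ x y)
    ; pres-unit    = coeff-Υ unitCe
    ; pres-Δ       = λ x → Eq-by-εL _≟HC2_ (ΔHC (Υ x)) ((ΥB ⊗ₘ ΥB) (ΔCe x)) (λ φ → εL-ΔHC-Υ φ x)
    ; pres-ε       = λ x → trans (εL-Υ εHCB x) (εL-cong εHCB≈εCeB x)
    }

mainTheorem13 : ∀ {c ℓ} (F : CharZeroField c ℓ) → Over.IsHopfIso F
mainTheorem13 = Υ-isHopfIso
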